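{- Suppose $C_1+\cdots+C_n\geq d\cdot(w_1+\cdots+w_n)+b(\underline{w})$ and that $\mathcal{B}_\bullet$ is a $1$-feasible partition. If $g_i(\mathcal{B}_\bullet)\leq g_i(\underline{w})-1$ for all $i=2,\dots,n$, then $\mathcal{B}_\bullet$ is feasible.
   Context: Setting: integers $w_1\geq\cdots\geq w_n\geq0$, positive integer $d$, integers $C_1\geq\cdots\geq C_n$. $\mathcal{B}$ is the multiset with $d$ balls of weight $w_i$ for each $i$. A partition $\mathcal{B}_\bullet$ is $\mathcal{B}=\mathcal{B}_1\sqcup\cdots\sqcup\mathcal{B}_n$ with each $\mathcal{B}_i$ containing exactly $d$ balls; $w(\mathcal{B}_i)$ is its total weight and $g_i(\mathcal{B}_\bullet)=C_i-w(\mathcal{B}_i)$. Feasible: all $g_i(\mathcal{B}_\bullet)\geq0$; $1$-feasible: $g_i(\mathcal{B}_\bullet)\geq0$ for $i\geq2$. Predecessor $p(w_i)=w_j$ where $j<i$ is the unique index with $w_j>w_{j+1}=\cdots=w_i$ ($p(w_i)=\infty$ if $w_i=w_1$); successor $s(w_i)=w_j$ where $j>i$ is the unique index with $w_i=\cdots=w_{j-1}>w_j$ ($s(w_i)=-\infty$ if $w_i=w_n$). For $i\geq2$: $g_i(\underline{w})=p(w_i)-w_i$ if $w_i\neq w_1$ and $g_i(\underline{w})=w_1-s(w_1)$ if $w_i=w_1$. $b(\underline{w})$: with $r=n$, conjugate $\lambda'_j=\#\{i:w_i\geq j\}$ ($1\le j\le w_1$), write $\lambda'=(r^{a_0},h_1^{a_1},\dots,h_k^{a_k})$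 ($c^a$ = $a$ entries equal to $c$), $a_0\geq0$, $a_t>0$, $r>h_1>\cdots>h_k>0$. If $k=0$, $b(\underline{w})=0$; otherwise with $h_0=r$, $b(\underline{w})=\sum_{t=1}^k(h_{t-1}-h_t)(a_t-1)+(h_k-1)(a_k-1)$. -}

module Defs where

open import Data.Nat as ℕ using (ℕ; zero; suc; _∸_; _<?_; _≟_)
open import Data.Integer as ℤ using (ℤ; +_; _-_)
open import Data.Fin using (Fin; toℕ) renaming (zero to fzero; suc to fsuc)
open import Data.List using (List; []; _∷_; filter; allFin; length; head; last; map; upTo)
open import Data.Maybe using (Maybe; just; nothing)
open import Data.Product using (_×_; _,_)
open import Data.Unit using (⊤)
open import Relation.Nullary using (yes; no)
open import Relation.Nullary.Decidable using (¬?)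
open import Relation.Binary.PropositionalEquality using (_≡_)

sumℕ : ∀ {n} → (Fin n → ℕ) → ℕ
sumℕ {zero}  f = 0
sumℕ {suc n} f = f fzero ℕ.+ sumℕ (λ i → f (fsuc i))

sumℤ : ∀ {n} → (Fin n → ℤ) → ℤ
sumℤ {zero}  f = + 0
sumℤ {suc n} f = f fzero ℤ.+ sumℤ (λ i → f (fsuc i))

-- Nonincreasing sequences (index 0 in Fin is the paper's index 1).

NonIncℕ : ∀ {n} → (Fin n → ℕ) → Set
NonIncℕ {n} w = ∀ (i j : Fin n) → toℕ i ℕ.≤ toℕ j → w j ℕ.≤ w i

NonIncℤ : ∀ {n} → (Fin n → ℤ) → Set
NonIncℤ {n} C = ∀ (i j : Fin n) → toℕ i ℕ.≤ toℕ j → C j ℤ.≤ C i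

-- A partition B_• of the multiset B (d balls of weight w_k for each k)
-- into n parts B_1, …, B_n of exactly d balls each, recorded by
-- count i k = number of the d balls of weight w_k that go into part B_i.

record Partition (n d : ℕ) : Set where
  field
    count  : Fin n → Fin n → ℕ
    partSz : ∀ i → sumℕ (λ k → count i k) ≡ d
    typeSz : ∀ k → sumℕ (λ i → count i k) ≡ d
open Partition public

weight : ∀ {n d} → (Fin n → ℕ) → Partition n d → Fin n → ℕ
weight w B i = sumℕ (λ k → count B i k ℕ.* w k)

gB : ∀ {n d} → (Fin n → ℕ) → (Fin n → ℤ) → Partition n d → Fin n → ℤ
gB w C B i = C i - + weight w B i

Feasible : ∀ {n d} → (Fin n → ℕ) → (Fin n → ℤ) → Partition n d → Set
Feasible w C B = ∀ i → + 0 ℤ.≤ gB w C B i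

OneFeasible : ∀ {n d} → (Fin n → ℕ) → (Fin n → ℤ) → Partition n d → Set
OneFeasible w C B = ∀ i → 1 ℕ.≤ toℕ i → + 0 ℤ.≤ gB w C B i

-- g_i(w) for i ≥ 2, with value in ℕ ∪ {∞}; nothing encodes +∞.
-- p(w_i) = w_j for the largest j < i with w_j ≠ w_i (this is the unique
-- j with w_j > w_{j+1} = ⋯ = w_i, for w nonincreasing);
-- s(w_1) = w_j for the smallest j > 1 with w_j ≠ w_1, or -∞ if none
-- (then g_i(w) = w_1 - (-∞) = +∞).

gw : ∀ {m} → (Fin (suc m) → ℕ) → Fin (suc m) → Maybe ℕ
gw {m} w i with w i ≟ w fzero
... | yes _ with head (filter (λ j → ¬? (w j ≟ w fzero))
                        (filter (λ j → 0 <? toℕ j) (allFin (suc m))))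
...   | just j  = just (w fzero ∸ w j)
...   | nothing = nothing
gw {m} w i | no _ with last (filter (λ j → ¬? (w j ≟ w i))
                        (filter (λ j → toℕ j <? toℕ i) (allFin (suc m))))
...   | just j  = just (w j ∸ w i)
...   | nothing = nothing   -- impossible (j = 1 qualifies)

≤gw-1 : ℤ → Maybe ℕ → Set
≤gw-1 x nothing  = ⊤
≤gw-1 x (just g) = x ℤ.≤ + g - + 1

rle : List ℕ → List (ℕ × ℕ)
rle [] = []
rle (x ∷ xs) with rle xs
... | [] = (x , 1) ∷ []
... | (y , a) ∷ rest with x ≟ y
...   | yes _ = (y , suc a) ∷ rest
...   | no _  = (x , 1) ∷ (y , a) ∷ rest

conj : ∀ {m} → (Fin (suc m) → ℕ) → List ℕ
conj {m} w = map (λ j → length (filter (λ i → suc j ℕ.≤? w i) (allFin (suc m))))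
                 (upTo (w fzero))

bSum : ℕ → List (ℕ × ℕ) → ℕ
bSum h₀ [] = 0
bSum h₀ ((h , a) ∷ []) = (h₀ ∸ h) ℕ.* (a ∸ 1) ℕ.+ (h ∸ 1) ℕ.* (a ∸ 1)
bSum h₀ ((h , a) ∷ rest@(_ ∷ _)) = (h₀ ∸ h) ℕ.* (a ∸ 1) ℕ.+ bSum h rest

bFrom : ℕ → List (ℕ × ℕ) → ℕ
bFrom r [] = 0
bFrom r ((h , a) ∷ rest) with h ≟ r
... | yes _ = bSum r rest
... | no _  = bSum r ((h , a) ∷ rest)

bw : ∀ {m} → (Fin (suc m) → ℕ) → ℕ
bw {m} w = bFrom (suc m) (rle (conj w))

module Submission where

-- Everything rests on the identity b(w) = Σ_{i≥2} (g_i(w) − 1), for w not constant. The conjugate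
-- partition λ' of w is obtained from that of (w_2, …, w_n) by adding 1 to every entry and appending
-- w_1 − w_2 entries equal to 1. Hence the blocks (h_t, a_t) of λ' are those of (w_2, …, w_n) with
-- every height raised by one, plus a last block (1, w_1 − w_2) when w_1 > w_2. By induction the last
-- block is (#{i : w_i = w_1}, w_1 − s(w_1)), and the remaining terms of b(w) add up g_i(w) − 1 over
-- the i with w_i < w_1.
-- Since Σ_i g_i(B_•) = Σ_i C_i − d Σ_i w_i ≥ b(w) ≥ Σ_{i≥2} g_i(B_•), we get g_1(B_•) ≥ 0.
-- For constant w all parts weigh d w_1, so g_1(B_•) ≥ g_2(B_•) ≥ 0 as C_1 ≥ C_2
-- (for n = 1 the hypothesis on Σ C_i is already g_1(B_•) ≥ 0).

open import Defs
open import Data.Nat using (ℕ; suc; _≤_)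
open import Data.Integer using (ℤ; +_; _+_; _*_; _≥_)
open import Data.Fin using (Fin; toℕ)

open import Data.Bool using (true; false; if_then_else_)
open import Data.Fin using () renaming (zero to fzero; suc to fsuc)
open import Data.Fin.Properties using (all?)
import Data.Integer as ℤ
import Data.Integer.Properties as ℤ
open import Data.Integer.Solver using (module +-*-Solver)
open import Data.List
  using (List; []; _∷_; _++_; [_]; map; replicate; applyUpTo; upTo; tabulate; filter; length; take; head; last; allFin)
import Data.List.Properties as List
open import Data.List.Relation.Unary.All using (All; []; _∷_)
open import Data.List.Relation.Unary.All.Properties using (applyUpTo⁺₁; tabulate⁺; tabulate⁻)
open import Data.Maybe as Maybe using (Maybe; just; nothing; fromMaybe)
import Data.Maybe.Properties as Maybe
open import Data.Nat as ℕ using (zero; _∸_; _<_; _≟_; _<?_; _≤?_; z≤n; s≤s)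
import Data.Nat.Properties as ℕ
open import Data.Product using (_×_; _,_; proj₁; proj₂; map₁; ∃)
open import Function using (_∘_)
open import Relation.Binary.PropositionalEquality
  using (_≡_; _≢_; refl; sym; trans; cong; cong₂; subst; subst₂; module ≡-Reasoning)
open import Relation.Nullary using (Dec; yes; no; ¬_; does; contradiction)
open import Relation.Nullary.Decidable using (dec-true; dec-false; ¬?; decidable-stable)
open import Relation.Unary using (Decidable)

open import Algebra.Properties.Semiring.Sum ℕ.+-*-semiring
  using (sum; sum-cong-≗; sum-replicate-zero; ∑-distrib-+; ∑-comm; *-distribˡ-sum; *-distribʳ-sum)

open ≡-Reasoning

𝟙 : ∀ {p} {P : Set p} → Dec P → ℕ
𝟙 P? = if does P? then 1 else 0

𝟙-yes : ∀ {p} {P : Set p} (P? : Dec P) → P → 𝟙 P? ≡ 1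
𝟙-yes P? p = cong (λ b → if b then 1 else 0) (dec-true P? p)

𝟙-no : ∀ {p} {P : Set p} (P? : Dec P) → ¬ P → 𝟙 P? ≡ 0
𝟙-no P? ¬p = cong (λ b → if b then 1 else 0) (dec-false P? ¬p)

-- Run-length encoding

liftHeights : List (ℕ × ℕ) → List (ℕ × ℕ)
liftHeights = map (map₁ suc)

rleCons : ℕ → List (ℕ × ℕ) → List (ℕ × ℕ)
rleCons x [] = (x , 1) ∷ []
rleCons x ((y , a) ∷ bs) with x ≟ y
... | yes _ = (y , suc a) ∷ bs
... | no _  = (x , 1) ∷ (y , a) ∷ bs

rle-∷ : ∀ x xs → rle (x ∷ xs) ≡ rleCons x (rle xs)
rle-∷ x xs with rle xs
... | [] = refl
... | (y , a) ∷ bs with x ≟ y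
...   | yes _ = refl
...   | no _  = refl

rleCons-suc : ∀ x bs → rleCons (suc x) (liftHeights bs) ≡ liftHeights (rleCons x bs)
rleCons-suc x [] = refl
rleCons-suc x ((y , a) ∷ bs) with x ≟ y | suc x ≟ suc y
... | yes _   | yes _   = refl
... | no _    | no _    = refl
... | yes x≡y | no sx≢sy = contradiction (cong suc x≡y) sx≢sy
... | no x≢y  | yes sx≡sy = contradiction (ℕ.suc-injective sx≡sy) x≢y

rle-map-suc : ∀ xs → rle (map suc xs) ≡ liftHeights (rle xs)
rle-map-suc [] = refl
rle-map-suc (x ∷ xs) = begin
  rle (suc x ∷ map suc xs)                ≡⟨ rle-∷ (suc x) (map suc xs) ⟩
  rleCons (suc x) (rle (map suc xs))      ≡⟨ cong (rleCons (suc x)) (rle-map-suc xs) ⟩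
  rleCons (suc x) (liftHeights (rle xs))  ≡⟨ rleCons-suc x (rle xs) ⟩
  liftHeights (rleCons x (rle xs))        ≡⟨ cong liftHeights (rle-∷ x xs) ⟨
  liftHeights (rle (x ∷ xs))              ∎

rle-replicate : ∀ a y → rle (replicate (suc a) y) ≡ [ y , suc a ]
rle-replicate zero    y = refl
rle-replicate (suc a) y
  rewrite rle-∷ y (replicate (suc a) y) | rle-replicate a y with y ≟ y
... | yes _   = refl
... | no y≢y  = contradiction refl y≢y

rleCons-∷ʳ : ∀ {x y} bs a → x ≢ y → rleCons x (bs ++ [ y , a ]) ≡ rleCons x bs ++ [ y , a ]
rleCons-∷ʳ {x} {y} [] a x≢y with x ≟ y
... | yes x≡y = contradiction x≡y x≢y
... | no _    = refl
rleCons-∷ʳ {x} ((z , c) ∷ bs) a _ with x ≟ z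
... | yes _ = refl
... | no _  = refl

rle-++-replicate : ∀ {y} xs a → All (_≢ y) xs →
                   rle (xs ++ replicate (suc a) y) ≡ rle xs ++ [ y , suc a ]
rle-++-replicate {y} [] a [] = rle-replicate a y
rle-++-replicate {y} (x ∷ xs) a (x≢y ∷ xs≢y) = begin
  rle (x ∷ xs ++ replicate (suc a) y)              ≡⟨ rle-∷ x (xs ++ replicate (suc a) y) ⟩
  rleCons x (rle (xs ++ replicate (suc a) y))      ≡⟨ cong (rleCons x) (rle-++-replicate xs a xs≢y) ⟩
  rleCons x (rle xs ++ [ y , suc a ])              ≡⟨ rleCons-∷ʳ (rle xs) (suc a) x≢y ⟩
  rleCons x (rle xs) ++ [ y , suc a ]              ≡⟨ cong (_++ [ y , suc a ]) (rle-∷ x xs) ⟨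
  rle (x ∷ xs) ++ [ y , suc a ]                    ∎

dropLevel : ℕ → List (ℕ × ℕ) → List (ℕ × ℕ)
dropLevel r [] = []
dropLevel r ((h , a) ∷ bs) with h ≟ r
... | yes _ = bs
... | no _  = (h , a) ∷ bs

bFrom≡bSum∘dropLevel : ∀ r bs → bFrom r bs ≡ bSum r (dropLevel r bs)
bFrom≡bSum∘dropLevel r [] = refl
bFrom≡bSum∘dropLevel r ((h , a) ∷ bs) with h ≟ r
... | yes _ = refl
... | no _  = refl

dropLevel-lift : ∀ r bs cs → dropLevel (suc r) cs ≡ cs →
                 dropLevel (suc r) (liftHeights bs ++ cs) ≡ liftHeights (dropLevel r bs) ++ cs
dropLevel-lift r [] cs eq = eq
dropLevel-lift r ((h , a) ∷ bs) cs _ with h ≟ r | suc h ≟ suc r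
... | yes _   | yes _     = refl
... | no _    | no _      = refl
... | yes h≡r | no sh≢sr  = contradiction (cong suc h≡r) sh≢sr
... | no h≢r  | yes sh≡sr = contradiction (ℕ.suc-injective sh≡sr) h≢r

dropLevel-rle-replicate : ∀ k r → dropLevel r (rle (replicate k r)) ≡ []
dropLevel-rle-replicate zero    r = refl
dropLevel-rle-replicate (suc k) r rewrite rle-replicate k r with r ≟ r
... | yes _  = refl
... | no r≢r = contradiction refl r≢r

stepSum : ℕ → List (ℕ × ℕ) → ℕ
stepSum h₀ [] = 0
stepSum h₀ ((h , a) ∷ bs) = (h₀ ∸ h) ℕ.* (a ∸ 1) ℕ.+ stepSum h bs

lastBlock : ℕ × ℕ → List (ℕ × ℕ) → ℕ × ℕ
lastBlock b []       = b
lastBlock _ (b ∷ bs) = lastBlock b bs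

corner : ℕ × ℕ → ℕ
corner (h , a) = (h ∸ 1) ℕ.* (a ∸ 1)

bSum≡stepSum+corner : ∀ h₀ bs → bSum h₀ bs ≡ stepSum h₀ bs ℕ.+ corner (lastBlock (h₀ , 0) bs)
bSum≡stepSum+corner h₀ [] = sym (ℕ.*-zeroʳ (h₀ ∸ 1))
bSum≡stepSum+corner h₀ ((h , a) ∷ []) =
  cong (ℕ._+ corner (h , a)) (sym (ℕ.+-identityʳ _))
bSum≡stepSum+corner h₀ ((h , a) ∷ bs@(_ ∷ _)) rewrite bSum≡stepSum+corner h bs =
  sym (ℕ.+-assoc ((h₀ ∸ h) ℕ.* (a ∸ 1)) (stepSum h bs) _)

stepSum-lift : ∀ h₀ bs → stepSum (suc h₀) (liftHeights bs) ≡ stepSum h₀ bs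
stepSum-lift h₀ [] = refl
stepSum-lift h₀ ((h , a) ∷ bs) = cong ((h₀ ∸ h) ℕ.* (a ∸ 1) ℕ.+_) (stepSum-lift h bs)

stepSum-∷ʳ : ∀ h₀ a₀ bs h a →
  stepSum h₀ (bs ++ [ h , a ]) ≡ stepSum h₀ bs ℕ.+ (proj₁ (lastBlock (h₀ , a₀) bs) ∸ h) ℕ.* (a ∸ 1)
stepSum-∷ʳ h₀ a₀ [] h a = ℕ.+-identityʳ _
stepSum-∷ʳ h₀ a₀ ((h′ , a′) ∷ bs) h a rewrite stepSum-∷ʳ h′ a′ bs h a =
  sym (ℕ.+-assoc ((h₀ ∸ h′) ℕ.* (a′ ∸ 1)) (stepSum h′ bs) _)

lastBlock-lift : ∀ b bs → lastBlock (map₁ suc b) (liftHeights bs) ≡ map₁ suc (lastBlock b bs)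
lastBlock-lift b []       = refl
lastBlock-lift _ (b ∷ bs) = lastBlock-lift b bs

lastBlock-∷ʳ : ∀ b bs c → lastBlock b (bs ++ [ c ]) ≡ c
lastBlock-∷ʳ b []       c = refl
lastBlock-∷ʳ _ (b ∷ bs) c = lastBlock-∷ʳ b bs c

-- The conjugate partition

applyUpTo-cong : ∀ {A : Set} {f g : ℕ → A} n → (∀ {j} → j < n → f j ≡ g j) →
                 applyUpTo f n ≡ applyUpTo g n
applyUpTo-cong zero    f≡g = refl
applyUpTo-cong (suc n) f≡g = cong₂ _∷_ (f≡g (s≤s z≤n)) (applyUpTo-cong n (f≡g ∘ s≤s))

applyUpTo-replicate : ∀ {A : Set} {f : ℕ → A} {x} n → (∀ {j} → j < n → f j ≡ x) →
                      applyUpTo f n ≡ replicate n x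
applyUpTo-replicate zero    f≡x = refl
applyUpTo-replicate (suc n) f≡x = cong₂ _∷_ (f≡x (s≤s z≤n)) (applyUpTo-replicate n (f≡x ∘ s≤s))

applyUpTo-+ : ∀ {A : Set} (f : ℕ → A) a b →
              applyUpTo f (a ℕ.+ b) ≡ applyUpTo f a ++ applyUpTo (f ∘ (a ℕ.+_)) b
applyUpTo-+ f zero    b = refl
applyUpTo-+ f (suc a) b = cong (f 0 ∷_) (applyUpTo-+ (f ∘ suc) a b)

length-filter-tabulate : ∀ {a p} {A : Set a} {P : A → Set p} (P? : Decidable P) {n} (f : Fin n → A) →
                         length (filter P? (tabulate f)) ≡ sum (λ i → 𝟙 (P? (f i)))
length-filter-tabulate P? {zero}  f = refl
length-filter-tabulate P? {suc n} f with does (P? (f fzero))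
... | true  = cong suc (length-filter-tabulate P? (f ∘ fsuc))
... | false = length-filter-tabulate P? (f ∘ fsuc)

-- columnHeight w j is the entry λ'_{j+1} of the conjugate partition.
columnHeight : ∀ {n} → (Fin n → ℕ) → ℕ → ℕ
columnHeight w j = sum (λ i → 𝟙 (suc j ≤? w i))

conj≡applyUpTo : ∀ {m} (w : Fin (suc m) → ℕ) → conj w ≡ applyUpTo (columnHeight w) (w fzero)
conj≡applyUpTo w = trans
  (List.map-cong (λ j → length-filter-tabulate (λ i → suc j ≤? w i) (λ i → i)) (upTo (w fzero)))
  (List.map-upTo (columnHeight w) (w fzero))

columnHeight-below : ∀ {n} (w : Fin (suc n) → ℕ) {j} → j < w fzero →
                     columnHeight w j ≡ suc (columnHeight (w ∘ fsuc) j)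
columnHeight-below w {j} j<w₀ = cong (ℕ._+ columnHeight (w ∘ fsuc) j) (𝟙-yes (suc j ≤? w fzero) j<w₀)

columnHeight-above : ∀ {n} (w : Fin n → ℕ) {j} → (∀ i → w i ≤ j) → columnHeight w j ≡ 0
columnHeight-above {n} w {j} w≤j = trans
  (sum-cong-≗ (λ i → 𝟙-no (suc j ≤? w i) (ℕ.≤⇒≯ (w≤j i))))
  (sum-replicate-zero n)

conj-∷ : ∀ {m} (w : Fin (suc (suc m)) → ℕ) → NonIncℕ w →
         conj w ≡ map suc (conj (w ∘ fsuc)) ++ replicate (w fzero ∸ w (fsuc fzero)) 1
conj-∷ w w↓ = begin
  conj w                                          ≡⟨ conj≡applyUpTo w ⟩
  applyUpTo H w₀                                  ≡⟨ cong (applyUpTo H) (ℕ.m+[n∸m]≡n w₁≤w₀) ⟨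
  applyUpTo H (w₁ ℕ.+ (w₀ ∸ w₁))                  ≡⟨ applyUpTo-+ H w₁ (w₀ ∸ w₁) ⟩
  applyUpTo H w₁ ++ applyUpTo (H ∘ (w₁ ℕ.+_)) (w₀ ∸ w₁)
    ≡⟨ cong₂ _++_ (applyUpTo-cong w₁ (λ j<w₁ → columnHeight-below w (ℕ.<-≤-trans j<w₁ w₁≤w₀)))
                  (applyUpTo-replicate (w₀ ∸ w₁) top-columns) ⟩
  applyUpTo (suc ∘ H′) w₁ ++ replicate (w₀ ∸ w₁) 1 ≡⟨ cong (_++ replicate (w₀ ∸ w₁) 1) lower-columns ⟩
  map suc (conj (w ∘ fsuc)) ++ replicate (w₀ ∸ w₁) 1 ∎
  where
    H  = columnHeight w
    H′ = columnHeight (w ∘ fsuc)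
    w₀ = w fzero
    w₁ = w (fsuc fzero)
    w₁≤w₀ = w↓ fzero (fsuc fzero) z≤n
    top-columns : ∀ {k} → k < w₀ ∸ w₁ → H (w₁ ℕ.+ k) ≡ 1
    top-columns {k} k<δ = begin
      H (w₁ ℕ.+ k)              ≡⟨ columnHeight-below w
                                     (ℕ.<-≤-trans (ℕ.+-monoʳ-< w₁ k<δ) (ℕ.≤-reflexive (ℕ.m+[n∸m]≡n w₁≤w₀))) ⟩
      suc (H′ (w₁ ℕ.+ k))       ≡⟨ cong suc (columnHeight-above (w ∘ fsuc)
                                     (λ i → ℕ.≤-trans (w↓ (fsuc fzero) (fsuc i) (s≤s z≤n)) (ℕ.m≤m+n w₁ k))) ⟩
      1                         ∎
    lower-columns : applyUpTo (suc ∘ H′) w₁ ≡ map suc (conj (w ∘ fsuc))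
    lower-columns = trans (sym (List.map-applyUpTo H′ suc w₁))
                          (cong (map suc) (sym (conj≡applyUpTo (w ∘ fsuc))))

-- The blocks (h_1, a_1), …, (h_k, a_k) of λ' = (r^{a_0}, h_1^{a_1}, …, h_k^{a_k}).
blocks : ∀ {m} → (Fin (suc m) → ℕ) → List (ℕ × ℕ)
blocks {m} w = dropLevel (suc m) (rle (conj w))

blocks-∷ : ∀ {m} (w : Fin (suc (suc m)) → ℕ) cs →
           rle (conj w) ≡ liftHeights (rle (conj (w ∘ fsuc))) ++ cs → dropLevel (2 ℕ.+ m) cs ≡ cs →
           blocks w ≡ liftHeights (blocks (w ∘ fsuc)) ++ cs
blocks-∷ {m} w cs rle≡ cs-kept =
  trans (cong (dropLevel (2 ℕ.+ m)) rle≡) (dropLevel-lift (suc m) (rle (conj (w ∘ fsuc))) cs cs-kept)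

module _ {m} (w : Fin (suc (suc m)) → ℕ) (w↓ : NonIncℕ w) where

  private
    lower = map suc (conj (w ∘ fsuc))

  blocks-flat : w (fsuc fzero) ≡ w fzero → blocks w ≡ liftHeights (blocks (w ∘ fsuc))
  blocks-flat w₁≡w₀ = trans (blocks-∷ w [] rle≡ refl) (List.++-identityʳ _)
    where
      rle≡ : rle (conj w) ≡ liftHeights (rle (conj (w ∘ fsuc))) ++ []
      rle≡ = begin
        rle (conj w)                                         ≡⟨ cong rle (conj-∷ w w↓) ⟩
        rle (lower ++ replicate (w fzero ∸ w (fsuc fzero)) 1)
          ≡⟨ cong (λ k → rle (lower ++ replicate k 1)) (trans (cong (w fzero ∸_) w₁≡w₀) (ℕ.n∸n≡0 (w fzero))) ⟩
        rle (lower ++ [])                                    ≡⟨ cong rle (List.++-identityʳ lower) ⟩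
        rle lower                                            ≡⟨ rle-map-suc (conj (w ∘ fsuc)) ⟩
        liftHeights (rle (conj (w ∘ fsuc)))                  ≡⟨ List.++-identityʳ _ ⟨
        liftHeights (rle (conj (w ∘ fsuc))) ++ []            ∎

  blocks-step : ∀ δ → w fzero ∸ w (fsuc fzero) ≡ suc δ →
                blocks w ≡ liftHeights (blocks (w ∘ fsuc)) ++ [ 1 , suc δ ]
  blocks-step δ w₀∸w₁≡1+δ = blocks-∷ w [ 1 , suc δ ] rle≡ refl
    where
      lower≢1 : All (_≢ 1) lower
      lower≢1 rewrite conj≡applyUpTo (w ∘ fsuc)
                    | List.map-applyUpTo (columnHeight (w ∘ fsuc)) suc (w (fsuc fzero))
        = applyUpTo⁺₁ _ (w (fsuc fzero))
            (λ j<w₁ eq → ℕ.0≢1+n (trans (sym (ℕ.suc-injective eq)) (columnHeight-below (w ∘ fsuc) j<w₁)))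

      rle≡ : rle (conj w) ≡ liftHeights (rle (conj (w ∘ fsuc))) ++ [ 1 , suc δ ]
      rle≡ = begin
        rle (conj w)                                           ≡⟨ cong rle (conj-∷ w w↓) ⟩
        rle (lower ++ replicate (w fzero ∸ w (fsuc fzero)) 1)  ≡⟨ cong (λ k → rle (lower ++ replicate k 1)) w₀∸w₁≡1+δ ⟩
        rle (lower ++ replicate (suc δ) 1)                     ≡⟨ rle-++-replicate lower δ lower≢1 ⟩
        rle lower ++ [ 1 , suc δ ]                             ≡⟨ cong (_++ [ 1 , suc δ ]) (rle-map-suc (conj (w ∘ fsuc))) ⟩
        liftHeights (rle (conj (w ∘ fsuc))) ++ [ 1 , suc δ ]   ∎

-- The gaps g_i(w)

≢? : ∀ c → Decidable (_≢ c)
≢? c x = ¬? (x ≟ c)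

filter-map : ∀ {A B : Set} {P : B → Set} (P? : Decidable P) (f : A → B) xs →
             filter P? (map f xs) ≡ map f (filter (P? ∘ f) xs)
filter-map P? f [] = refl
filter-map P? f (x ∷ xs) with does (P? (f x))
... | true  = cong (f x ∷_) (filter-map P? f xs)
... | false = filter-map P? f xs

select-filter-map : ∀ {A B C : Set} {P : B → Set} (P? : Decidable P) (f : A → B) (g : B → C)
  (select : ∀ {X : Set} → List X → Maybe X) → (∀ ys → select (map f ys) ≡ Maybe.map f (select ys)) → ∀ xs →
  Maybe.map (g ∘ f) (select (filter (P? ∘ f) xs)) ≡ Maybe.map g (select (filter P? (map f xs)))
select-filter-map P? f g select select-map xs = begin
  Maybe.map (g ∘ f) (select (filter (P? ∘ f) xs))         ≡⟨ Maybe.map-∘ (select (filter (P? ∘ f) xs)) ⟩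
  Maybe.map g (Maybe.map f (select (filter (P? ∘ f) xs))) ≡⟨ cong (Maybe.map g) (select-map (filter (P? ∘ f) xs)) ⟨
  Maybe.map g (select (map f (filter (P? ∘ f) xs)))       ≡⟨ cong (Maybe.map g ∘ select) (filter-map P? f xs) ⟨
  Maybe.map g (select (filter P? (map f xs)))             ∎

filter-positive : ∀ m → filter (λ j → 0 <? toℕ j) (allFin (suc m)) ≡ tabulate fsuc
filter-positive m = trans (List.filter-reject (λ j → 0 <? toℕ j) {x = fzero} {xs = tabulate fsuc} (λ ()))
                          (List.filter-all (λ j → 0 <? toℕ j) (tabulate⁺ {f = fsuc} (λ _ → s≤s z≤n)))

filter-below : ∀ {k} T → filter (λ j → toℕ j <? T) (allFin k) ≡ take T (allFin k)
filter-below {zero}  zero    = refl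
filter-below {zero}  (suc T) = refl
filter-below {suc k} zero    = List.filter-none (λ j → toℕ j <? 0) (tabulate⁺ {f = λ j → j} (λ _ ()))
filter-below {suc k} (suc T) = begin
  filter (λ j → toℕ j <? suc T) (fzero ∷ tabulate fsuc)
    ≡⟨ List.filter-accept (λ j → toℕ j <? suc T) {x = fzero} {xs = tabulate fsuc} (s≤s z≤n) ⟩
  fzero ∷ filter (λ j → toℕ j <? suc T) (tabulate fsuc)
    ≡⟨ cong (λ js → fzero ∷ filter (λ j → toℕ j <? suc T) js) (List.map-tabulate (λ j → j) fsuc) ⟨
  fzero ∷ filter (λ j → toℕ j <? suc T) (map fsuc (allFin k))
    ≡⟨ cong (fzero ∷_) (filter-map (λ j → toℕ j <? suc T) fsuc (allFin k)) ⟩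
  fzero ∷ map fsuc (filter (λ j → suc (toℕ j) <? suc T) (allFin k))
    ≡⟨ cong (λ js → fzero ∷ map fsuc js)
            (List.filter-≐ (λ j → suc (toℕ j) <? suc T) (λ j → toℕ j <? T) (ℕ.s≤s⁻¹ , s≤s) (allFin k)) ⟩
  fzero ∷ map fsuc (filter (λ j → toℕ j <? T) (allFin k))
    ≡⟨ cong (λ js → fzero ∷ map fsuc js) (filter-below T) ⟩
  fzero ∷ map fsuc (take T (allFin k))
    ≡⟨ cong (fzero ∷_) (List.take-map T (allFin k)) ⟨
  fzero ∷ take T (map fsuc (allFin k))
    ≡⟨ cong (λ js → fzero ∷ take T js) (List.map-tabulate (λ j → j) fsuc) ⟩
  take (suc T) (allFin (suc k)) ∎

gw-top : ∀ {m} (w : Fin (suc m) → ℕ) {i} → w i ≡ w fzero →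
         gw w i ≡ Maybe.map (w fzero ∸_) (head (filter (≢? (w fzero)) (tabulate (w ∘ fsuc))))
gw-top {m} w {i} wᵢ≡w₀ = begin
  gw w i
    ≡⟨ unfold ⟩
  Maybe.map ((w fzero ∸_) ∘ w) (head (filter (≢? (w fzero) ∘ w) later))
    ≡⟨ select-filter-map (≢? (w fzero)) w (w fzero ∸_) head List.head-map later ⟩
  Maybe.map (w fzero ∸_) (head (filter (≢? (w fzero)) (map w later)))
    ≡⟨ cong (λ xs → Maybe.map (w fzero ∸_) (head (filter (≢? (w fzero)) xs)))
            (trans (cong (map w) (filter-positive m)) (List.map-tabulate fsuc w)) ⟩
  Maybe.map (w fzero ∸_) (head (filter (≢? (w fzero)) (tabulate (w ∘ fsuc)))) ∎
  where
    later = filter (λ j → 0 <? toℕ j) (allFin (suc m))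
    unfold : gw w i ≡ Maybe.map ((w fzero ∸_) ∘ w) (head (filter (≢? (w fzero) ∘ w) later))
    unfold with w i ≟ w fzero
    ... | no wᵢ≢w₀ = contradiction wᵢ≡w₀ wᵢ≢w₀
    ... | yes _ with head (filter (≢? (w fzero) ∘ w) later)
    ...   | just _  = refl
    ...   | nothing = refl

gw-nonTop : ∀ {m} (w : Fin (suc m) → ℕ) {i} → w i ≢ w fzero →
            gw w i ≡ Maybe.map (_∸ w i) (last (filter (≢? (w i)) (take (toℕ i) (tabulate w))))
gw-nonTop {m} w {i} wᵢ≢w₀ = begin
  gw w i
    ≡⟨ unfold ⟩
  Maybe.map ((_∸ w i) ∘ w) (last (filter (≢? (w i) ∘ w) earlier))
    ≡⟨ select-filter-map (≢? (w i)) w (_∸ w i) last (List.last-map w) earlier ⟩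
  Maybe.map (_∸ w i) (last (filter (≢? (w i)) (map w earlier)))
    ≡⟨ cong (λ xs → Maybe.map (_∸ w i) (last (filter (≢? (w i)) xs)))
            (trans (cong (map w) (filter-below (toℕ i)))
            (trans (sym (List.take-map (toℕ i) (allFin (suc m))))
                   (cong (take (toℕ i)) (List.map-tabulate (λ j → j) w)))) ⟩
  Maybe.map (_∸ w i) (last (filter (≢? (w i)) (take (toℕ i) (tabulate w)))) ∎
  where
    earlier = filter (λ j → toℕ j <? toℕ i) (allFin (suc m))
    unfold : gw w i ≡ Maybe.map ((_∸ w i) ∘ w) (last (filter (≢? (w i) ∘ w) earlier))
    unfold with w i ≟ w fzero
    ... | yes wᵢ≡w₀ = contradiction wᵢ≡w₀ wᵢ≢w₀
    ... | no _ with last (filter (≢? (w i) ∘ w) earlier)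
    ...   | just _  = refl
    ...   | nothing = refl

head-filter-nothing : ∀ {A : Set} {P : A → Set} (P? : Decidable P) xs →
                      head (filter P? xs) ≡ nothing → All (¬_ ∘ P) xs
head-filter-nothing P? []       _ = []
head-filter-nothing P? (x ∷ xs) h with P? x
head-filter-nothing P? (x ∷ xs) () | yes _
... | no ¬px = ¬px ∷ head-filter-nothing P? xs h

take-tabulate⁺ : ∀ {A : Set} {P : A → Set} {k} (f : Fin k → A) t →
                 (∀ j → toℕ j < t → P (f j)) → All P (take t (tabulate f))
take-tabulate⁺ {k = zero}  f zero    Pf = []
take-tabulate⁺ {k = zero}  f (suc t) Pf = []
take-tabulate⁺ {k = suc k} f zero    Pf = []
take-tabulate⁺ {k = suc k} f (suc t) Pf =
  Pf fzero (s≤s z≤n) ∷ take-tabulate⁺ (f ∘ fsuc) t (λ j j<t → Pf (fsuc j) (s≤s j<t))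

last-∷ : ∀ {A : Set} (x : A) xs → ∃ λ y → last (x ∷ xs) ≡ just y
last-∷ x []       = x , refl
last-∷ x (y ∷ xs) = last-∷ y xs

module _ {m} (w : Fin (suc m) → ℕ) where

  gw-top≡gw-fzero : ∀ {i} → w i ≡ w fzero → gw w i ≡ gw w fzero
  gw-top≡gw-fzero wᵢ≡w₀ = trans (gw-top w wᵢ≡w₀) (sym (gw-top w refl))

  gw-fzero-nothing : gw w fzero ≡ nothing → ∀ k → w k ≡ w fzero
  gw-fzero-nothing _           fzero    = refl
  gw-fzero-nothing gw₀≡nothing (fsuc j) = decidable-stable (w (fsuc j) ≟ w fzero)
    (tabulate⁻ (head-filter-nothing (≢? (w fzero)) (tabulate (w ∘ fsuc)) no-lower-value) j)
    where
      no-lower-value : head (filter (≢? (w fzero)) (tabulate (w ∘ fsuc))) ≡ nothing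
      no-lower-value with head (filter (≢? (w fzero)) (tabulate (w ∘ fsuc)))
                        | trans (sym (gw-top w refl)) gw₀≡nothing
      ... | nothing | _ = refl

  gw-nonTop-just : ∀ {i} → w i ≢ w fzero → ∃ λ g → gw w i ≡ just g
  gw-nonTop-just {fzero}  w₀≢w₀ = contradiction refl w₀≢w₀
  gw-nonTop-just {fsuc k} wᵢ≢w₀ = proj₁ last-just ∸ v , (begin
    gw w (fsuc k)
      ≡⟨ gw-nonTop w wᵢ≢w₀ ⟩
    Maybe.map (_∸ v) (last (filter (≢? v) (w fzero ∷ rest)))
      ≡⟨ cong (Maybe.map (_∸ v) ∘ last) (List.filter-accept (≢? v) (wᵢ≢w₀ ∘ sym)) ⟩
    Maybe.map (_∸ v) (last (w fzero ∷ filter (≢? v) rest))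
      ≡⟨ cong (Maybe.map (_∸ v)) (proj₂ last-just) ⟩
    just (proj₁ last-just ∸ v) ∎)
    where
      v = w (fsuc k)
      rest = take (toℕ k) (tabulate (w ∘ fsuc))
      last-just = last-∷ (w fzero) (filter (≢? v) rest)

module _ {m} (w : Fin (suc (suc m)) → ℕ) where

  private
    w₀ = w fzero
    w₁ = w (fsuc fzero)

  gw-flat : w₁ ≡ w₀ → gw w fzero ≡ gw (w ∘ fsuc) fzero
  gw-flat w₁≡w₀ = begin
    gw w fzero
      ≡⟨ gw-top w refl ⟩
    Maybe.map (w₀ ∸_) (head (filter (≢? w₀) (w₁ ∷ rest)))
      ≡⟨ cong (Maybe.map (w₀ ∸_) ∘ head) (List.filter-reject (≢? w₀) (λ w₁≢w₀ → w₁≢w₀ w₁≡w₀)) ⟩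
    Maybe.map (w₀ ∸_) (head (filter (≢? w₀) rest))
      ≡⟨ cong (λ c → Maybe.map (c ∸_) (head (filter (≢? c) rest))) w₁≡w₀ ⟨
    Maybe.map (w₁ ∸_) (head (filter (≢? w₁) rest))
      ≡⟨ gw-top (w ∘ fsuc) refl ⟨
    gw (w ∘ fsuc) fzero ∎
    where rest = tabulate (w ∘ fsuc ∘ fsuc)

  gw-step : w₁ ≢ w₀ → gw w fzero ≡ just (w₀ ∸ w₁)
  gw-step w₁≢w₀ = trans (gw-top w refl)
    (cong (Maybe.map (w₀ ∸_) ∘ head) (List.filter-accept (≢? w₀) {xs = tabulate (w ∘ fsuc ∘ fsuc)} w₁≢w₀))

  gw-shift : ∀ {i} → w (fsuc i) ≢ w₀ → w (fsuc i) ≢ w₁ → gw w (fsuc i) ≡ gw (w ∘ fsuc) i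
  gw-shift {fzero}  _       w₁≢w₁ = contradiction refl w₁≢w₁
  gw-shift {fsuc k} wᵢ≢w₀ wᵢ≢w₁ = begin
    gw w (fsuc (fsuc k))
      ≡⟨ gw-nonTop w wᵢ≢w₀ ⟩
    Maybe.map (_∸ v) (last (filter (≢? v) (w₀ ∷ w₁ ∷ rest)))
      ≡⟨ cong (Maybe.map (_∸ v) ∘ last) (List.filter-accept (≢? v) (wᵢ≢w₀ ∘ sym)) ⟩
    Maybe.map (_∸ v) (last (w₀ ∷ filter (≢? v) (w₁ ∷ rest)))
      ≡⟨ cong (λ xs → Maybe.map (_∸ v) (last (w₀ ∷ xs))) (List.filter-accept (≢? v) (wᵢ≢w₁ ∘ sym)) ⟩
    Maybe.map (_∸ v) (last (w₁ ∷ filter (≢? v) rest))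
      ≡⟨ cong (Maybe.map (_∸ v) ∘ last) (List.filter-accept (≢? v) (wᵢ≢w₁ ∘ sym)) ⟨
    Maybe.map (_∸ v) (last (filter (≢? v) (w₁ ∷ rest)))
      ≡⟨ gw-nonTop (w ∘ fsuc) wᵢ≢w₁ ⟨
    gw (w ∘ fsuc) (fsuc k) ∎
    where
      v = w (fsuc (fsuc k))
      rest = take (toℕ k) (tabulate (w ∘ fsuc ∘ fsuc))

  gw-secondLevel : NonIncℕ w → w₁ ≢ w₀ → ∀ {i} → w (fsuc i) ≡ w₁ → gw w (fsuc i) ≡ just (w₀ ∸ w₁)
  gw-secondLevel w↓ w₁≢w₀ {i} wᵢ≡w₁ = begin
    gw w (fsuc i)
      ≡⟨ gw-nonTop w (λ wᵢ≡w₀ → w₁≢w₀ (trans (sym wᵢ≡w₁) wᵢ≡w₀)) ⟩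
    Maybe.map (_∸ v) (last (filter (≢? v) (w₀ ∷ rest)))
      ≡⟨ cong (Maybe.map (_∸ v) ∘ last)
              (List.filter-accept (≢? v) (λ w₀≡wᵢ → w₁≢w₀ (trans (sym wᵢ≡w₁) (sym w₀≡wᵢ)))) ⟩
    Maybe.map (_∸ v) (last (w₀ ∷ filter (≢? v) rest))
      ≡⟨ cong (λ xs → Maybe.map (_∸ v) (last (w₀ ∷ xs)))
              (List.filter-none (≢? v) (take-tabulate⁺ (w ∘ fsuc) (toℕ i) same-level)) ⟩
    just (w₀ ∸ v)
      ≡⟨ cong (λ x → just (w₀ ∸ x)) wᵢ≡w₁ ⟩
    just (w₀ ∸ w₁) ∎
    where
      v = w (fsuc i)
      rest = take (toℕ i) (tabulate (w ∘ fsuc))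
      same-level : ∀ j → toℕ j < toℕ i → ¬ (w (fsuc j) ≢ v)
      same-level j j<i wⱼ≢v = wⱼ≢v (ℕ.≤-antisym
        (ℕ.≤-trans (w↓ (fsuc fzero) (fsuc j) (s≤s z≤n)) (ℕ.≤-reflexive (sym wᵢ≡w₁)))
        (w↓ (fsuc j) (fsuc i) (s≤s (ℕ.<⇒≤ j<i))))

-- b(w) as a sum of gaps

-- g_i(w), with ∞ (which occurs only for constant w) read as 0.
gapAt : ∀ {m} → (Fin (suc m) → ℕ) → Fin (suc m) → ℕ
gapAt w i = fromMaybe 0 (gw w i)

topCount : ∀ {m} → (Fin (suc m) → ℕ) → ℕ
topCount w = sum (λ i → 𝟙 (w i ≟ w fzero))

lowerDefect : ∀ {m} → (Fin (suc m) → ℕ) → Fin (suc m) → ℕ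
lowerDefect w i = if does (w i ≟ w fzero) then 0 else gapAt w i ∸ 1

lowerDefect-top : ∀ {m} (w : Fin (suc m) → ℕ) {i} → w i ≡ w fzero → lowerDefect w i ≡ 0
lowerDefect-top w {i} wᵢ≡w₀ = cong (λ b → if b then 0 else gapAt w i ∸ 1) (dec-true (w i ≟ w fzero) wᵢ≡w₀)

lowerDefect-nonTop : ∀ {m} (w : Fin (suc m) → ℕ) {i} → w i ≢ w fzero → lowerDefect w i ≡ gapAt w i ∸ 1
lowerDefect-nonTop w {i} wᵢ≢w₀ = cong (λ b → if b then 0 else gapAt w i ∸ 1) (dec-false (w i ≟ w fzero) wᵢ≢w₀)

topCount-∷ : ∀ {m} (w : Fin (suc m) → ℕ) → topCount w ≡ suc (sum (λ i → 𝟙 (w (fsuc i) ≟ w fzero)))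
topCount-∷ w = cong (ℕ._+ sum (λ i → 𝟙 (w (fsuc i) ≟ w fzero))) (𝟙-yes (w fzero ≟ w fzero) refl)

BlocksInvariant : ∀ {m} → (Fin (suc m) → ℕ) → Set
BlocksInvariant {m} w = lastBlock (suc m , 0) (blocks w) ≡ (topCount w , gapAt w fzero)
                      × stepSum (suc m) (blocks w) ≡ sum (lowerDefect w)

blocks-single : (w : Fin 1 → ℕ) → blocks w ≡ []
blocks-single w = trans (cong (dropLevel 1 ∘ rle)
                              (trans (conj≡applyUpTo w) (applyUpTo-replicate (w fzero) (columnHeight-below w))))
                        (dropLevel-rle-replicate (w fzero) 1)

invariant-single : (w : Fin 1 → ℕ) → BlocksInvariant w
invariant-single w rewrite blocks-single w =
  cong₂ _,_ (sym (cong (ℕ._+ 0) (𝟙-yes (w fzero ≟ w fzero) refl))) (cong (fromMaybe 0) (sym (gw-top w refl))) ,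
  sym (cong (ℕ._+ 0) (lowerDefect-top w refl))

module _ {m} (w : Fin (suc (suc m)) → ℕ) (w↓ : NonIncℕ w) where

  private
    w₀ = w fzero
    w₁ = w (fsuc fzero)
    w′ = w ∘ fsuc

  module _ (w₁≡w₀ : w₁ ≡ w₀) where

    lowerDefect-flat : ∀ i → lowerDefect w (fsuc i) ≡ lowerDefect w′ i
    lowerDefect-flat i = by-level (w (fsuc i) ≟ w₀)
      where
        by-level : Dec (w (fsuc i) ≡ w₀) → lowerDefect w (fsuc i) ≡ lowerDefect w′ i
        by-level (yes wᵢ≡w₀) =
          trans (lowerDefect-top w wᵢ≡w₀) (sym (lowerDefect-top w′ (trans wᵢ≡w₀ (sym w₁≡w₀))))
        by-level (no wᵢ≢w₀)  = begin
          lowerDefect w (fsuc i) ≡⟨ lowerDefect-nonTop w wᵢ≢w₀ ⟩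
          gapAt w (fsuc i) ∸ 1   ≡⟨ cong (λ g → fromMaybe 0 g ∸ 1) (gw-shift w wᵢ≢w₀ wᵢ≢w₁) ⟩
          gapAt w′ i ∸ 1         ≡⟨ lowerDefect-nonTop w′ wᵢ≢w₁ ⟨
          lowerDefect w′ i       ∎
          where wᵢ≢w₁ = λ wᵢ≡w₁ → wᵢ≢w₀ (trans wᵢ≡w₁ w₁≡w₀)

    invariant-flat : BlocksInvariant w′ → BlocksInvariant w
    invariant-flat (last≡ , stepSum≡) = last-flat , stepSum-flat
      where
        last-flat : lastBlock (2 ℕ.+ m , 0) (blocks w) ≡ (topCount w , gapAt w fzero)
        last-flat = begin
          lastBlock (2 ℕ.+ m , 0) (blocks w)                ≡⟨ cong (lastBlock _) (blocks-flat w w↓ w₁≡w₀) ⟩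
          lastBlock (2 ℕ.+ m , 0) (liftHeights (blocks w′)) ≡⟨ lastBlock-lift (suc m , 0) (blocks w′) ⟩
          map₁ suc (lastBlock (suc m , 0) (blocks w′))      ≡⟨ cong (map₁ suc) last≡ ⟩
          (suc (topCount w′) , gapAt w′ fzero)
            ≡⟨ cong₂ _,_ (trans (cong suc (sum-cong-≗ (λ i → cong (λ c → 𝟙 (w′ i ≟ c)) w₁≡w₀)))
                                (sym (topCount-∷ w)))
                         (cong (fromMaybe 0) (sym (gw-flat w w₁≡w₀))) ⟩
          (topCount w , gapAt w fzero)                      ∎

        stepSum-flat : stepSum (2 ℕ.+ m) (blocks w) ≡ sum (lowerDefect w)
        stepSum-flat = begin
          stepSum (2 ℕ.+ m) (blocks w)                ≡⟨ cong (stepSum _) (blocks-flat w w↓ w₁≡w₀) ⟩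
          stepSum (2 ℕ.+ m) (liftHeights (blocks w′)) ≡⟨ stepSum-lift (suc m) (blocks w′) ⟩
          stepSum (suc m) (blocks w′)                 ≡⟨ stepSum≡ ⟩
          sum (lowerDefect w′)                        ≡⟨ sum-cong-≗ lowerDefect-flat ⟨
          sum (lowerDefect w ∘ fsuc)                  ≡⟨ cong (ℕ._+ sum (lowerDefect w ∘ fsuc)) (lowerDefect-top w refl) ⟨
          sum (lowerDefect w)                         ∎

  module _ (δ : ℕ) (w₀∸w₁≡1+δ : w₀ ∸ w₁ ≡ suc δ) where

    private
      w₁≢w₀ : w₁ ≢ w₀
      w₁≢w₀ w₁≡w₀ = ℕ.0≢1+n (trans (sym (trans (cong (w₀ ∸_) w₁≡w₀) (ℕ.n∸n≡0 w₀))) w₀∸w₁≡1+δ)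

      below-top : ∀ i → w (fsuc i) ≢ w₀
      below-top i wᵢ≡w₀ = w₁≢w₀ (ℕ.≤-antisym (w↓ fzero (fsuc fzero) z≤n)
        (ℕ.≤-trans (ℕ.≤-reflexive (sym wᵢ≡w₀)) (w↓ (fsuc fzero) (fsuc i) (s≤s z≤n))))

    topCount≡1 : topCount w ≡ 1
    topCount≡1 = trans (topCount-∷ w) (cong suc (trans
      (sum-cong-≗ (λ i → 𝟙-no (w (fsuc i) ≟ w₀) (below-top i))) (sum-replicate-zero (suc m))))

    lowerDefect-step : ∀ i → lowerDefect w (fsuc i) ≡ 𝟙 (w′ i ≟ w₁) ℕ.* δ ℕ.+ lowerDefect w′ i
    lowerDefect-step i = by-level (w′ i ≟ w₁)
      where
        by-level : Dec (w′ i ≡ w₁) → lowerDefect w (fsuc i) ≡ 𝟙 (w′ i ≟ w₁) ℕ.* δ ℕ.+ lowerDefect w′ i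
        by-level (yes wᵢ≡w₁) = begin
          lowerDefect w (fsuc i)   ≡⟨ lowerDefect-nonTop w (below-top i) ⟩
          gapAt w (fsuc i) ∸ 1     ≡⟨ cong (λ g → fromMaybe 0 g ∸ 1) (gw-secondLevel w w↓ w₁≢w₀ wᵢ≡w₁) ⟩
          w₀ ∸ w₁ ∸ 1              ≡⟨ cong (_∸ 1) w₀∸w₁≡1+δ ⟩
          δ                        ≡⟨ trans (ℕ.+-identityʳ (1 ℕ.* δ)) (ℕ.*-identityˡ δ) ⟨
          1 ℕ.* δ ℕ.+ 0            ≡⟨ cong₂ (λ t d → t ℕ.* δ ℕ.+ d) (𝟙-yes (w′ i ≟ w₁) wᵢ≡w₁)
                                            (lowerDefect-top w′ wᵢ≡w₁) ⟨
          𝟙 (w′ i ≟ w₁) ℕ.* δ ℕ.+ lowerDefect w′ i ∎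
        by-level (no wᵢ≢w₁) = begin
          lowerDefect w (fsuc i)   ≡⟨ lowerDefect-nonTop w (below-top i) ⟩
          gapAt w (fsuc i) ∸ 1     ≡⟨ cong (λ g → fromMaybe 0 g ∸ 1) (gw-shift w (below-top i) wᵢ≢w₁) ⟩
          gapAt w′ i ∸ 1           ≡⟨ lowerDefect-nonTop w′ wᵢ≢w₁ ⟨
          lowerDefect w′ i         ≡⟨ cong (λ t → t ℕ.* δ ℕ.+ lowerDefect w′ i) (𝟙-no (w′ i ≟ w₁) wᵢ≢w₁) ⟨
          𝟙 (w′ i ≟ w₁) ℕ.* δ ℕ.+ lowerDefect w′ i ∎

    invariant-step : BlocksInvariant w′ → BlocksInvariant w
    invariant-step (last≡ , stepSum≡) = last-step , stepSum-step
      where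
        top-block = [ 1 , suc δ ]

        last-step : lastBlock (2 ℕ.+ m , 0) (blocks w) ≡ (topCount w , gapAt w fzero)
        last-step = begin
          lastBlock (2 ℕ.+ m , 0) (blocks w)
            ≡⟨ cong (lastBlock _) (blocks-step w w↓ δ w₀∸w₁≡1+δ) ⟩
          lastBlock (2 ℕ.+ m , 0) (liftHeights (blocks w′) ++ top-block)
            ≡⟨ lastBlock-∷ʳ _ (liftHeights (blocks w′)) (1 , suc δ) ⟩
          (1 , suc δ)
            ≡⟨ cong₂ _,_ (sym topCount≡1) (sym (trans (cong (fromMaybe 0) (gw-step w w₁≢w₀)) w₀∸w₁≡1+δ)) ⟩
          (topCount w , gapAt w fzero) ∎

        stepSum-step : stepSum (2 ℕ.+ m) (blocks w) ≡ sum (lowerDefect w)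
        stepSum-step = begin
          stepSum (2 ℕ.+ m) (blocks w)
            ≡⟨ cong (stepSum _) (blocks-step w w↓ δ w₀∸w₁≡1+δ) ⟩
          stepSum (2 ℕ.+ m) (liftHeights (blocks w′) ++ top-block)
            ≡⟨ stepSum-∷ʳ (2 ℕ.+ m) 0 (liftHeights (blocks w′)) 1 (suc δ) ⟩
          stepSum (2 ℕ.+ m) (liftHeights (blocks w′))
            ℕ.+ (proj₁ (lastBlock (2 ℕ.+ m , 0) (liftHeights (blocks w′))) ∸ 1) ℕ.* δ
            ≡⟨ cong₂ (λ s h → s ℕ.+ (h ∸ 1) ℕ.* δ) (stepSum-lift (suc m) (blocks w′))
                     (cong proj₁ (trans (lastBlock-lift (suc m , 0) (blocks w′)) (cong (map₁ suc) last≡))) ⟩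
          stepSum (suc m) (blocks w′) ℕ.+ topCount w′ ℕ.* δ
            ≡⟨ cong₂ ℕ._+_ stepSum≡ (*-distribʳ-sum δ (λ i → 𝟙 (w′ i ≟ w₁))) ⟩
          sum (lowerDefect w′) ℕ.+ sum (λ i → 𝟙 (w′ i ≟ w₁) ℕ.* δ)
            ≡⟨ ℕ.+-comm (sum (lowerDefect w′)) _ ⟩
          sum (λ i → 𝟙 (w′ i ≟ w₁) ℕ.* δ) ℕ.+ sum (lowerDefect w′)
            ≡⟨ ∑-distrib-+ (λ i → 𝟙 (w′ i ≟ w₁) ℕ.* δ) (lowerDefect w′) ⟨
          sum (λ i → 𝟙 (w′ i ≟ w₁) ℕ.* δ ℕ.+ lowerDefect w′ i)
            ≡⟨ sum-cong-≗ lowerDefect-step ⟨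
          sum (lowerDefect w ∘ fsuc)
            ≡⟨ cong (ℕ._+ sum (lowerDefect w ∘ fsuc)) (lowerDefect-top w refl) ⟨
          sum (lowerDefect w) ∎

blocks-invariant : ∀ {m} (w : Fin (suc m) → ℕ) → NonIncℕ w → BlocksInvariant w
blocks-invariant {zero}  w _  = invariant-single w
blocks-invariant {suc m} w w↓ = by-first-gap (w (fsuc fzero) ≟ w fzero) (w fzero ∸ w (fsuc fzero)) refl
  where
    invariant′ : BlocksInvariant (w ∘ fsuc)
    invariant′ = blocks-invariant (w ∘ fsuc) (λ i j i≤j → w↓ (fsuc i) (fsuc j) (s≤s i≤j))

    by-first-gap : Dec (w (fsuc fzero) ≡ w fzero) → ∀ δ → w fzero ∸ w (fsuc fzero) ≡ δ → BlocksInvariant w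
    by-first-gap (yes w₁≡w₀) _       _         = invariant-flat w w↓ w₁≡w₀ invariant′
    by-first-gap (no w₁≢w₀)  zero    w₀∸w₁≡0   =
      contradiction (ℕ.≤-antisym (w↓ fzero (fsuc fzero) z≤n) (ℕ.m∸n≡0⇒m≤n w₀∸w₁≡0)) w₁≢w₀
    by-first-gap (no _)      (suc δ) w₀∸w₁≡1+δ = invariant-step w w↓ δ w₀∸w₁≡1+δ invariant′

gap∸1-split : ∀ {m} (w : Fin (suc m) → ℕ) i →
              gapAt w i ∸ 1 ≡ lowerDefect w i ℕ.+ 𝟙 (w i ≟ w fzero) ℕ.* (gapAt w fzero ∸ 1)
gap∸1-split w i = by-level (w i ≟ w fzero)
  where
    by-level : Dec (w i ≡ w fzero) →
               gapAt w i ∸ 1 ≡ lowerDefect w i ℕ.+ 𝟙 (w i ≟ w fzero) ℕ.* (gapAt w fzero ∸ 1)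
    by-level (yes wᵢ≡w₀) = begin
      gapAt w i ∸ 1               ≡⟨ cong (λ g → fromMaybe 0 g ∸ 1) (gw-top≡gw-fzero w wᵢ≡w₀) ⟩
      gapAt w fzero ∸ 1           ≡⟨ ℕ.*-identityˡ (gapAt w fzero ∸ 1) ⟨
      1 ℕ.* (gapAt w fzero ∸ 1)   ≡⟨ cong₂ (λ d t → d ℕ.+ t ℕ.* (gapAt w fzero ∸ 1))
                                          (lowerDefect-top w wᵢ≡w₀) (𝟙-yes (w i ≟ w fzero) wᵢ≡w₀) ⟨
      lowerDefect w i ℕ.+ 𝟙 (w i ≟ w fzero) ℕ.* (gapAt w fzero ∸ 1) ∎
    by-level (no wᵢ≢w₀) = begin
      gapAt w i ∸ 1               ≡⟨ lowerDefect-nonTop w wᵢ≢w₀ ⟨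
      lowerDefect w i             ≡⟨ ℕ.+-identityʳ (lowerDefect w i) ⟨
      lowerDefect w i ℕ.+ 0       ≡⟨ cong (λ t → lowerDefect w i ℕ.+ t ℕ.* (gapAt w fzero ∸ 1))
                                          (𝟙-no (w i ≟ w fzero) wᵢ≢w₀) ⟨
      lowerDefect w i ℕ.+ 𝟙 (w i ≟ w fzero) ℕ.* (gapAt w fzero ∸ 1) ∎

bw≡∑gap∸1 : ∀ {m} (w : Fin (suc m) → ℕ) → NonIncℕ w → bw w ≡ sum (λ i → gapAt w (fsuc i) ∸ 1)
bw≡∑gap∸1 {m} w w↓ = begin
  bw w
    ≡⟨ bFrom≡bSum∘dropLevel (suc m) (rle (conj w)) ⟩
  bSum (suc m) (blocks w)
    ≡⟨ bSum≡stepSum+corner (suc m) (blocks w) ⟩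
  stepSum (suc m) (blocks w) ℕ.+ corner (lastBlock (suc m , 0) (blocks w))
    ≡⟨ cong₂ ℕ._+_ stepSum≡ (cong corner last≡) ⟩
  sum (lowerDefect w) ℕ.+ (topCount w ∸ 1) ℕ.* g′
    ≡⟨ cong₂ (λ d t → d ℕ.+ (t ∸ 1) ℕ.* g′)
             (cong (ℕ._+ sum (lowerDefect w ∘ fsuc)) (lowerDefect-top w refl)) (topCount-∷ w) ⟩
  sum (lowerDefect w ∘ fsuc) ℕ.+ sum (λ i → 𝟙 (w (fsuc i) ≟ w fzero)) ℕ.* g′
    ≡⟨ cong (sum (lowerDefect w ∘ fsuc) ℕ.+_) (*-distribʳ-sum g′ (λ i → 𝟙 (w (fsuc i) ≟ w fzero))) ⟩
  sum (lowerDefect w ∘ fsuc) ℕ.+ sum (λ i → 𝟙 (w (fsuc i) ≟ w fzero) ℕ.* g′)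
    ≡⟨ ∑-distrib-+ (lowerDefect w ∘ fsuc) (λ i → 𝟙 (w (fsuc i) ≟ w fzero) ℕ.* g′) ⟨
  sum (λ i → lowerDefect w (fsuc i) ℕ.+ 𝟙 (w (fsuc i) ≟ w fzero) ℕ.* g′)
    ≡⟨ sum-cong-≗ (λ i → gap∸1-split w (fsuc i)) ⟨
  sum (λ i → gapAt w (fsuc i) ∸ 1) ∎
  where
    g′ = gapAt w fzero ∸ 1
    last≡ = proj₁ (blocks-invariant w w↓)
    stepSum≡ = proj₂ (blocks-invariant w w↓)

-- Partitions and feasibility

sumℕ≡sum : ∀ {n} (f : Fin n → ℕ) → sumℕ f ≡ sum f
sumℕ≡sum {zero}  f = refl
sumℕ≡sum {suc n} f = cong (f fzero ℕ.+_) (sumℕ≡sum (f ∘ fsuc))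

∑weight≡d*∑w : ∀ {n d} (w : Fin n → ℕ) (B : Partition n d) → sum (weight w B) ≡ d ℕ.* sum w
∑weight≡d*∑w {d = d} w B = begin
  sum (λ i → sumℕ (λ k → count B i k ℕ.* w k)) ≡⟨ sum-cong-≗ (λ i → sumℕ≡sum (λ k → count B i k ℕ.* w k)) ⟩
  sum (λ i → sum (λ k → count B i k ℕ.* w k))  ≡⟨ ∑-comm (λ i k → count B i k ℕ.* w k) ⟩
  sum (λ k → sum (λ i → count B i k ℕ.* w k))  ≡⟨ sum-cong-≗ (λ k → *-distribʳ-sum (w k) (λ i → count B i k)) ⟨
  sum (λ k → sum (λ i → count B i k) ℕ.* w k)  ≡⟨ sum-cong-≗ (λ k → cong (ℕ._* w k) (part-count k)) ⟩
  sum (λ k → d ℕ.* w k)                         ≡⟨ *-distribˡ-sum d w ⟨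
  d ℕ.* sum w                                   ∎
  where
    part-count : ∀ k → sum (λ i → count B i k) ≡ d
    part-count k = trans (sym (sumℕ≡sum (λ i → count B i k))) (typeSz B k)

weight-constant : ∀ {n d} (w : Fin n → ℕ) (B : Partition n d) {c} → (∀ k → w k ≡ c) → ∀ i → weight w B i ≡ d ℕ.* c
weight-constant {d = d} w B {c} w≡c i = begin
  sumℕ (λ k → count B i k ℕ.* w k) ≡⟨ sumℕ≡sum (λ k → count B i k ℕ.* w k) ⟩
  sum (λ k → count B i k ℕ.* w k)  ≡⟨ sum-cong-≗ (λ k → cong (count B i k ℕ.*_) (w≡c k)) ⟩
  sum (λ k → count B i k ℕ.* c)    ≡⟨ *-distribʳ-sum c (count B i) ⟨
  sum (count B i) ℕ.* c            ≡⟨ cong (ℕ._* c) (trans (sym (sumℕ≡sum (count B i))) (partSz B i)) ⟩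
  d ℕ.* c                          ∎

+-cancelʳ-≤ : ∀ k {i j} → i + k ℤ.≤ j + k → i ℤ.≤ j
+-cancelʳ-≤ k i+k≤j+k = ℤ.≮⇒≥ (λ j<i → ℤ.<⇒≱ (ℤ.+-monoˡ-< k j<i) i+k≤j+k)

sumℤ-mono-≤ : ∀ {n} {f g : Fin n → ℤ} → (∀ i → f i ℤ.≤ g i) → sumℤ f ℤ.≤ sumℤ g
sumℤ-mono-≤ {zero}  f≤g = ℤ.≤-refl
sumℤ-mono-≤ {suc n} f≤g = ℤ.+-mono-≤ (f≤g fzero) (sumℤ-mono-≤ (f≤g ∘ fsuc))

sumℤ-+ : ∀ {n} (f : Fin n → ℕ) → sumℤ (λ i → + f i) ≡ + sum f
sumℤ-+ {zero}  f = refl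
sumℤ-+ {suc n} f = cong (λ s → + f fzero + s) (sumℤ-+ (f ∘ fsuc))

sumℤ-minus : ∀ {n} (f : Fin n → ℤ) (g : Fin n → ℕ) → sumℤ (λ i → f i ℤ.- + g i) + + sum g ≡ sumℤ f
sumℤ-minus {zero}  f g = refl
sumℤ-minus {suc n} f g = begin
  (f fzero ℤ.- + g fzero) + s + (+ g fzero + + sum (g ∘ fsuc)) ≡⟨ regroup (f fzero) (+ g fzero) s (+ sum (g ∘ fsuc)) ⟩
  f fzero + (s + + sum (g ∘ fsuc))                              ≡⟨ cong (λ s → f fzero + s) (sumℤ-minus (f ∘ fsuc) (g ∘ fsuc)) ⟩
  f fzero + sumℤ (f ∘ fsuc)                                    ∎
  where
    s = sumℤ (λ i → f (fsuc i) ℤ.- + g (fsuc i))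
    regroup : ∀ a b c e → (a ℤ.- b) + c + (b + e) ≡ a + (c + e)
    regroup = solve 4 (λ a b c e → (a :- b) :+ c :+ (b :+ e) := a :+ (c :+ e)) refl
      where open +-*-Solver

head-nonneg : ∀ {n} (g : Fin (suc n) → ℤ) (b : Fin n → ℕ) →
              (∀ i → g (fsuc i) ℤ.≤ + b i) → + sum b ℤ.≤ sumℤ g → + 0 ℤ.≤ g fzero
head-nonneg g b g≤b ∑b≤∑g = +-cancelʳ-≤ (+ sum b) (ℤ.≤-trans ∑b≤∑g ∑g≤g₀+∑b)
  where
    ∑g≤g₀+∑b : sumℤ g ℤ.≤ g fzero + + sum b
    ∑g≤g₀+∑b = ℤ.≤-trans (ℤ.+-monoʳ-≤ (g fzero) (sumℤ-mono-≤ g≤b))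
                         (ℤ.≤-reflexive (cong (λ s → g fzero + s) (sumℤ-+ b)))

gw-just : ∀ {m} (w : Fin (suc m) → ℕ) → ¬ (∀ k → w k ≡ w fzero) → ∀ i → ∃ λ g → gw w i ≡ just g
gw-just w nonconstant i = by-level (w i ≟ w fzero)
  where
    top-gap : ∃ λ g → gw w fzero ≡ just g
    top-gap with gw w fzero in gw₀≡
    ... | just g  = g , refl
    ... | nothing = contradiction (gw-fzero-nothing w gw₀≡) nonconstant

    by-level : Dec (w i ≡ w fzero) → ∃ λ g → gw w i ≡ just g
    by-level (yes wᵢ≡w₀) = proj₁ top-gap , trans (gw-top≡gw-fzero w wᵢ≡w₀) (proj₂ top-gap)
    by-level (no wᵢ≢w₀)  = gw-nonTop-just w wᵢ≢w₀

≤gw-1⇒≤pred : ∀ {x g} {mg : Maybe ℕ} → mg ≡ just g → + 0 ℤ.≤ x → ≤gw-1 x mg → x ℤ.≤ + (fromMaybe 0 mg ∸ 1)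
≤gw-1⇒≤pred {g = zero}  refl 0≤x x≤-1 = contradiction (ℤ.≤-trans 0≤x x≤-1) λ ()
≤gw-1⇒≤pred {g = suc g} refl _   x≤g  = x≤g

module _ {m d} (w : Fin (suc m) → ℕ) (C : Fin (suc m) → ℤ) (B : Partition (suc m) d) where

  bw≤∑gB : sumℤ C ≥ (+ d) * (+ sumℕ w) + (+ bw w) → + bw w ℤ.≤ sumℤ (gB w C B)
  bw≤∑gB ∑C≥ = +-cancelʳ-≤ (+ (d ℕ.* sum w)) (subst₂ ℤ._≤_ reorder total ∑C≥)
    where
      reorder : + d * + sumℕ w + + bw w ≡ + bw w + + (d ℕ.* sum w)
      reorder = begin
        + d * + sumℕ w + + bw w    ≡⟨ cong (λ s → + d * + s + + bw w) (sumℕ≡sum w) ⟩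
        + d * + sum w + + bw w     ≡⟨ cong (λ x → x + + bw w) (ℤ.pos-* d (sum w)) ⟨
        + (d ℕ.* sum w) + + bw w   ≡⟨ ℤ.+-comm (+ (d ℕ.* sum w)) (+ bw w) ⟩
        + bw w + + (d ℕ.* sum w)   ∎

      total : sumℤ C ≡ sumℤ (gB w C B) + + (d ℕ.* sum w)
      total = begin
        sumℤ C                                ≡⟨ sumℤ-minus C (weight w B) ⟨
        sumℤ (gB w C B) + + sum (weight w B)  ≡⟨ cong (λ s → sumℤ (gB w C B) + + s) (∑weight≡d*∑w w B) ⟩
        sumℤ (gB w C B) + + (d ℕ.* sum w)     ∎

  gB≤gap∸1 : OneFeasible w C B → (∀ i → 1 ≤ toℕ i → ≤gw-1 (gB w C B i) (gw w i)) →
             ¬ (∀ k → w k ≡ w fzero) → ∀ i → gB w C B (fsuc i) ℤ.≤ + (gapAt w (fsuc i) ∸ 1)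
  gB≤gap∸1 feasible₁ gB≤gw-1 nonconstant i =
    ≤gw-1⇒≤pred (proj₂ (gw-just w nonconstant (fsuc i)))
                (feasible₁ (fsuc i) (s≤s z≤n)) (gB≤gw-1 (fsuc i) (s≤s z≤n))

gB-second≤first : ∀ {m d} (w : Fin (suc (suc m)) → ℕ) (C : Fin (suc (suc m)) → ℤ)
                  (B : Partition (suc (suc m)) d) → NonIncℤ C →
                  weight w B fzero ≡ weight w B (fsuc fzero) → gB w C B (fsuc fzero) ℤ.≤ gB w C B fzero
gB-second≤first w C B C↓ W₀≡W₁ =
  subst (λ W₀ → gB w C B (fsuc fzero) ℤ.≤ C fzero ℤ.- + W₀) (sym W₀≡W₁)
        (ℤ.+-monoˡ-≤ (ℤ.- + weight w B (fsuc fzero)) (C↓ fzero (fsuc fzero) z≤n))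

first-feasible-constant : ∀ {m d} (w : Fin (suc m) → ℕ) (C : Fin (suc m) → ℤ) → NonIncℤ C →
  sumℤ C ≥ (+ d) * (+ sumℕ w) + (+ bw w) → (B : Partition (suc m) d) → OneFeasible w C B →
  (∀ k → w k ≡ w fzero) → + 0 ℤ.≤ gB w C B fzero
first-feasible-constant {zero}  w C _  ∑C≥ B _ _ =
  head-nonneg (gB w C B) (λ ()) (λ ()) (ℤ.≤-trans (ℤ.+≤+ z≤n) (bw≤∑gB w C B ∑C≥))
first-feasible-constant {suc m} w C C↓ _ B feasible₁ constant =
  ℤ.≤-trans (feasible₁ (fsuc fzero) (s≤s z≤n)) (gB-second≤first w C B C↓ W₀≡W₁)
  where
    W₀≡W₁ = trans (weight-constant w B constant fzero) (sym (weight-constant w B constant (fsuc fzero)))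

corollary5p3 : (m d : ℕ) → 1 ≤ d →
    (w : Fin (suc m) → ℕ) → NonIncℕ w →
    (C : Fin (suc m) → ℤ) → NonIncℤ C →
    sumℤ C ≥ (+ d) * (+ sumℕ w) + (+ bw w) →
    (B : Partition (suc m) d) → OneFeasible w C B →
    (∀ i → 1 ≤ toℕ i → ≤gw-1 (gB w C B i) (gw w i)) →
    Feasible w C B
corollary5p3 m d _ w w↓ C C↓ ∑C≥ B feasible₁ gB≤gw-1 (fsuc i) = feasible₁ (fsuc i) (s≤s z≤n)
corollary5p3 m d _ w w↓ C C↓ ∑C≥ B feasible₁ gB≤gw-1 fzero with all? (λ k → w k ≟ w fzero)
... | yes constant   = first-feasible-constant w C C↓ ∑C≥ B feasible₁ constant
... | no nonconstant = head-nonneg (gB w C B) (λ i → gapAt w (fsuc i) ∸ 1)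
  (gB≤gap∸1 w C B feasible₁ gB≤gw-1 nonconstant)
  (subst (λ b → + b ℤ.≤ sumℤ (gB w C B)) (bw≡∑gap∸1 w w↓) (bw≤∑gB w C B ∑C≥))
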